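{- Let $q\geq 2$ be even. Then there is a completely regular code in $H(3,q)$ with covering radius $1$, eigenvalue $\lambda_2(3,q)$ and parameter $\gamma=q/2$.
   Context: Let $\mathcal{A}$ be a set of size $q$; $H(3,q)$ has vertex set $\mathcal{A}^3$, tuples adjacent iff they differ in exactly one position; $\lambda_2(3,q)=q-3$. A set $C$ of vertices is a completely regular code with covering radius $1$ if $C$ is a nonempty proper subset and there are integers $\beta,\gamma\geq1$ such that every vertex of $C$ has exactly $\beta$ neighbours outside $C$ and every vertex outside $C$ has exactly $\gamma$ neighbours in $C$; it has eigenvalue $\lambda_2(3,q)$ iff $\beta+\gamma=2q$. -}

module Defs where

open import Data.Nat using (ℕ; zero; suc; _+_; _*_; _≡ᵇ_; _≤_)
open import Data.Bool using (Bool; true; false; if_then_else_; not; _∧_)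
open import Data.Fin using (Fin; _≟_)
open import Data.List using (List; []; _∷_; concatMap; map)
open import Data.Fin.Base using ()
open import Data.List using () renaming (allFin to allFinL)
open import Data.Product using (_×_; _,_; ∃-syntax)
open import Relation.Nullary.Decidable using (does)
open import Relation.Binary.PropositionalEquality using (_≡_)

Vertex : ℕ → Set
Vertex q = Fin q × Fin q × Fin q

diff : ∀ {q} → Fin q → Fin q → ℕ
diff a b = if does (a ≟ b) then 0 else 1

dist : ∀ {q} → Vertex q → Vertex q → ℕ
dist (a₁ , a₂ , a₃) (b₁ , b₂ , b₃) = diff a₁ b₁ + diff a₂ b₂ + diff a₃ b₃

adjacent : ∀ {q} → Vertex q → Vertex q → Bool
adjacent u v = dist u v ≡ᵇ 1

allVertices : (q : ℕ) → List (Vertex q)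
allVertices q =
  concatMap (λ a → concatMap (λ b → map (λ c → (a , b , c)) (allFinL q)) (allFinL q)) (allFinL q)

countB : ∀ {A : Set} → (A → Bool) → List A → ℕ
countB p [] = 0
countB p (x ∷ xs) = (if p x then 1 else 0) + countB p xs

Code : ℕ → Set
Code q = Vertex q → Bool

nbrsIn : ∀ {q} → Code q → Vertex q → ℕ
nbrsIn {q} C v = countB (λ w → adjacent v w ∧ C w) (allVertices q)

nbrsOut : ∀ {q} → Code q → Vertex q → ℕ
nbrsOut {q} C v = countB (λ w → adjacent v w ∧ not (C w)) (allVertices q)

record IsCRC1 (q : ℕ) (C : Code q) (β γ : ℕ) : Set where
  field
    nonempty : ∃[ v ] (C v ≡ true)
    proper   : ∃[ v ] (C v ≡ false)
    β≥1      : 1 ≤ β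
    γ≥1      : 1 ≤ γ
    inC      : ∀ v → C v ≡ true → nbrsOut C v ≡ β
    outC     : ∀ v → C v ≡ false → nbrsIn C v ≡ γ

-- eigenvalue λ₂(3,q) = q - 3 characterised (per the paper) by β + γ = 2q
HasEigenvalueλ₂ : (q β γ : ℕ) → Set
HasEigenvalueλ₂ q β γ = β + γ ≡ 2 * q

-- The code consists of the vertices whose three coordinates have the same parity,
-- the alphabet Fin (2m) being split into m even and m odd symbols.  Moving along a
-- coordinate line through a vertex v reaches m symbols of each parity, so the
-- neighbours of v whose parity pattern differs from v's in that coordinate number m.
-- A codeword leaves the code along each of its three lines (β = 3m); a non-codeword
-- has exactly one coordinate whose parity is the odd one out, and re-enters the code
-- only along that line (γ = m).  Hence β + γ = 4m = 2q.
module Submission where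

open import Defs
open import Data.Nat using (ℕ; zero; suc; _+_; _*_; _≡ᵇ_; _≤_; s≤s; z≤n)
open import Data.Nat.Properties
  using (+-0-commutativeMonoid; +-assoc; +-comm; +-identityʳ; *-identityʳ; *-zeroʳ; *-distribˡ-+)
open import Data.Nat.Divisibility using (_∣_; divides)
open import Data.Nat.DivMod using (_/_; m*n/n≡m)
open import Data.Nat.Tactic.RingSolver using (solve-∀)
open import Data.Bool using (Bool; true; false; if_then_else_; not; _∧_)
open import Data.Fin using (Fin; zero; suc; _≟_; punchIn)
open import Data.Fin.Properties using (punchInᵢ≢i)
open import Data.List using (List; []; _∷_; _++_; concatMap; map; tabulate; allFin)
open import Data.List.Properties using (map-tabulate)
open import Data.Product using (_×_; _,_; ∃-syntax)
open import Function using (_∘_)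
open import Relation.Nullary.Decidable using (dec-true; dec-false)
open import Relation.Binary.PropositionalEquality
open import Algebra.Properties.CommutativeMonoid.Sum +-0-commutativeMonoid
  using (sum-syntax; sum-cong-≗; sum-remove; sum-replicate-zero)
open ≡-Reasoning

𝟙 : Bool → ℕ
𝟙 b = if b then 1 else 0

countB-++ : ∀ {A : Set} (p : A → Bool) xs ys → countB p (xs ++ ys) ≡ countB p xs + countB p ys
countB-++ p []       ys = refl
countB-++ p (x ∷ xs) ys = trans (cong (𝟙 (p x) +_) (countB-++ p xs ys)) (sym (+-assoc (𝟙 (p x)) _ _))

countB-tabulate : ∀ {A : Set} (p : A → Bool) {n} (f : Fin n → A) →
  countB p (tabulate f) ≡ ∑[ i < n ] 𝟙 (p (f i))
countB-tabulate p {zero}  f = refl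
countB-tabulate p {suc n} f = cong (𝟙 (p (f zero)) +_) (countB-tabulate p (f ∘ suc))

countB-concatMap-tabulate : ∀ {A B : Set} (p : B → Bool) (f : A → List B) {n} (g : Fin n → A) →
  countB p (concatMap f (tabulate g)) ≡ ∑[ i < n ] countB p (f (g i))
countB-concatMap-tabulate p f {zero}  g = refl
countB-concatMap-tabulate p f {suc n} g = begin
  countB p (f (g zero) ++ concatMap f (tabulate (g ∘ suc)))   ≡⟨ countB-++ p (f (g zero)) _ ⟩
  countB p (f (g zero)) + countB p (concatMap f (tabulate (g ∘ suc)))
    ≡⟨ cong (countB p (f (g zero)) +_) (countB-concatMap-tabulate p f (g ∘ suc)) ⟩
  countB p (f (g zero)) + ∑[ i < n ] countB p (f (g (suc i)))  ∎

countB-allVertices : ∀ {q} (p : Vertex q → Bool) →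
  countB p (allVertices q) ≡ ∑[ x < q ] ∑[ y < q ] ∑[ z < q ] 𝟙 (p (x , y , z))
countB-allVertices {q} p =
  trans (countB-concatMap-tabulate p plane (λ x → x)) (sum-cong-≗ λ x →
  trans (countB-concatMap-tabulate p (line x) (λ y → y)) (sum-cong-≗ λ y →
  trans (cong (countB p) (map-tabulate (λ z → z) (λ z → (x , y , z))))
        (countB-tabulate p (λ z → (x , y , z)))))
  where
  line : Fin q → Fin q → List (Vertex q)
  line x y = map (λ z → (x , y , z)) (allFin q)
  plane : Fin q → List (Vertex q)
  plane x = concatMap (line x) (allFin q)

diff-refl : ∀ {q} (a : Fin q) → diff a a ≡ 0
diff-refl a = cong (λ b → if b then 0 else 1) (dec-true (a ≟ a) refl)

diff-punchIn : ∀ {n} (a : Fin (suc n)) (x : Fin n) → diff a (punchIn a x) ≡ 1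
diff-punchIn a x =
  cong (λ b → if b then 0 else 1) (dec-false (a ≟ punchIn a x) (punchInᵢ≢i a x ∘ sym))

sum-split-at : ∀ {n} (a : Fin (suc n)) (F : ℕ → Fin (suc n) → ℕ) →
  ∑[ x < suc n ] F (diff a x) x ≡ F 0 a + ∑[ x < n ] F 1 (punchIn a x)
sum-split-at a F = begin
  ∑[ x < _ ] F (diff a x) x                                        ≡⟨ sum-remove {i = a} (λ x → F (diff a x) x) ⟩
  F (diff a a) a + ∑[ x < _ ] F (diff a (punchIn a x)) (punchIn a x)
    ≡⟨ cong₂ _+_ (cong (λ d → F d a) (diff-refl a))
                 (sum-cong-≗ λ x → cong (λ d → F d (punchIn a x)) (diff-punchIn a x)) ⟩
  F 0 a + ∑[ x < _ ] F 1 (punchIn a x)                             ∎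

sum-diff≡ᵇ0 : ∀ {n} (c : Fin (suc n)) (h : Fin (suc n) → Bool) →
  ∑[ z < suc n ] 𝟙 ((diff c z ≡ᵇ 0) ∧ h z) ≡ 𝟙 (h c)
sum-diff≡ᵇ0 {n} c h = begin
  ∑[ z < suc n ] 𝟙 ((diff c z ≡ᵇ 0) ∧ h z)  ≡⟨ sum-split-at c (λ d z → 𝟙 ((d ≡ᵇ 0) ∧ h z)) ⟩
  𝟙 (h c) + ∑[ z < n ] 0                     ≡⟨ cong (𝟙 (h c) +_) (sum-replicate-zero n) ⟩
  𝟙 (h c) + 0                                ≡⟨ +-identityʳ _ ⟩
  𝟙 (h c)                                    ∎

sum-diff≡ᵇ1 : ∀ {n} (c : Fin (suc n)) (h : Fin (suc n) → Bool) →
  ∑[ z < suc n ] 𝟙 ((diff c z ≡ᵇ 1) ∧ h z) ≡ ∑[ z < n ] 𝟙 (h (punchIn c z))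
sum-diff≡ᵇ1 c h = sum-split-at c (λ d z → 𝟙 ((d ≡ᵇ 1) ∧ h z))

sum₂-dist≡ᵇ0 : ∀ {n} (b c : Fin (suc n)) (h : Fin (suc n) → Fin (suc n) → Bool) →
  ∑[ y < suc n ] ∑[ z < suc n ] 𝟙 ((diff b y + diff c z ≡ᵇ 0) ∧ h y z) ≡ 𝟙 (h b c)
sum₂-dist≡ᵇ0 {n} b c h = begin
  ∑[ y < suc n ] ∑[ z < suc n ] 𝟙 ((diff b y + diff c z ≡ᵇ 0) ∧ h y z)
    ≡⟨ sum-split-at b (λ d y → ∑[ z < suc n ] 𝟙 ((d + diff c z ≡ᵇ 0) ∧ h y z)) ⟩
  ∑[ z < suc n ] 𝟙 ((diff c z ≡ᵇ 0) ∧ h b z) + ∑[ y < n ] ∑[ z < suc n ] 0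
    ≡⟨ cong₂ _+_ (sum-diff≡ᵇ0 c (h b))
                 (trans (sum-cong-≗ {n} λ _ → sum-replicate-zero (suc n)) (sum-replicate-zero n)) ⟩
  𝟙 (h b c) + 0                                                      ≡⟨ +-identityʳ _ ⟩
  𝟙 (h b c)                                                          ∎

sum₂-dist≡ᵇ1 : ∀ {n} (b c : Fin (suc n)) (h : Fin (suc n) → Fin (suc n) → Bool) →
  ∑[ y < suc n ] ∑[ z < suc n ] 𝟙 ((diff b y + diff c z ≡ᵇ 1) ∧ h y z) ≡
  ∑[ y < n ] 𝟙 (h (punchIn b y) c) + ∑[ z < n ] 𝟙 (h b (punchIn c z))
sum₂-dist≡ᵇ1 {n} b c h = begin
  ∑[ y < suc n ] ∑[ z < suc n ] 𝟙 ((diff b y + diff c z ≡ᵇ 1) ∧ h y z)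
    ≡⟨ sum-split-at b (λ d y → ∑[ z < suc n ] 𝟙 ((d + diff c z ≡ᵇ 1) ∧ h y z)) ⟩
  ∑[ z < suc n ] 𝟙 ((diff c z ≡ᵇ 1) ∧ h b z) +
  ∑[ y < n ] ∑[ z < suc n ] 𝟙 ((diff c z ≡ᵇ 0) ∧ h (punchIn b y) z)
    ≡⟨ cong₂ _+_ (sum-diff≡ᵇ1 c (h b)) (sum-cong-≗ λ y → sum-diff≡ᵇ0 c (h (punchIn b y))) ⟩
  ∑[ z < n ] 𝟙 (h b (punchIn c z)) + ∑[ y < n ] 𝟙 (h (punchIn b y) c)
    ≡⟨ +-comm (∑[ z < n ] 𝟙 (h b (punchIn c z))) _ ⟩
  ∑[ y < n ] 𝟙 (h (punchIn b y) c) + ∑[ z < n ] 𝟙 (h b (punchIn c z))  ∎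

-- Each coordinate is peeled off with sum-split-at: a differing coordinate uses up the
-- one allowed difference, as `1 + k ≡ᵇ 1` reduces to `k ≡ᵇ 0` and `1 + k ≡ᵇ 0` to false.
nbrsIn-lines : ∀ {n} (C : Code (suc n)) (a b c : Fin (suc n)) →
  nbrsIn C (a , b , c) ≡
  ∑[ x < n ] 𝟙 (C (punchIn a x , b , c)) + ∑[ y < n ] 𝟙 (C (a , punchIn b y , c)) +
  ∑[ z < n ] 𝟙 (C (a , b , punchIn c z))
nbrsIn-lines {n} C a b c = begin
  nbrsIn C (a , b , c)
    ≡⟨ countB-allVertices (λ w → adjacent (a , b , c) w ∧ C w) ⟩
  ∑[ x < suc n ] ∑[ y < suc n ] ∑[ z < suc n ] 𝟙 ((diff a x + diff b y + diff c z ≡ᵇ 1) ∧ C (x , y , z))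
    ≡⟨ sum-split-at a (λ d x → ∑[ y < suc n ] ∑[ z < suc n ]
                                 𝟙 ((d + diff b y + diff c z ≡ᵇ 1) ∧ C (x , y , z))) ⟩
  ∑[ y < suc n ] ∑[ z < suc n ] 𝟙 ((diff b y + diff c z ≡ᵇ 1) ∧ C (a , y , z)) +
  ∑[ x < n ] ∑[ y < suc n ] ∑[ z < suc n ] 𝟙 ((diff b y + diff c z ≡ᵇ 0) ∧ C (punchIn a x , y , z))
    ≡⟨ cong₂ _+_ (sum₂-dist≡ᵇ1 b c (λ y z → C (a , y , z)))
                 (sum-cong-≗ λ x → sum₂-dist≡ᵇ0 b c (λ y z → C (punchIn a x , y , z))) ⟩
  (Ly + Lz) + Lx     ≡⟨ +-comm (Ly + Lz) Lx ⟩
  Lx + (Ly + Lz)     ≡⟨ +-assoc Lx Ly Lz ⟨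
  Lx + Ly + Lz       ∎
  where
  Lx Ly Lz : ℕ
  Lx = ∑[ x < n ] 𝟙 (C (punchIn a x , b , c))
  Ly = ∑[ y < n ] 𝟙 (C (a , punchIn b y , c))
  Lz = ∑[ z < n ] 𝟙 (C (a , b , punchIn c z))

parity : ∀ {n} → Fin n → Bool
parity zero          = false
parity (suc zero)    = true
parity (suc (suc x)) = parity x

sum-parity : ∀ m (f : Bool → ℕ) → ∑[ x < m * 2 ] f (parity x) ≡ m * f true + m * f false
sum-parity zero    f = refl
sum-parity (suc m) f = begin
  f false + (f true + ∑[ x < m * 2 ] f (parity x))  ≡⟨ cong (λ s → f false + (f true + s)) (sum-parity m f) ⟩
  f false + (f true + (m * f true + m * f false))    ≡⟨ swap-middle (f true) (f false) (m * f true) (m * f false) ⟩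
  (f true + m * f true) + (f false + m * f false)    ∎
  where
  swap-middle : ∀ u v s t → v + (u + (s + t)) ≡ (u + s) + (v + t)
  swap-middle = solve-∀

*-𝟙-true+false≡not : ∀ M (H : Bool → Bool) p → H p ≡ false →
  M * 𝟙 (H true) + M * 𝟙 (H false) ≡ M * 𝟙 (H (not p))
*-𝟙-true+false≡not M H true  Hp≡false rewrite Hp≡false = cong (_+ M * 𝟙 (H false)) (*-zeroʳ M)
*-𝟙-true+false≡not M H false Hp≡false rewrite Hp≡false = trans (cong (M * 𝟙 (H true) +_) (*-zeroʳ M)) (+-identityʳ _)

sum-punchIn-parity : ∀ m (a : Fin (suc m * 2)) (H : Bool → Bool) → H (parity a) ≡ false →
  ∑[ x < suc (m * 2) ] 𝟙 (H (parity (punchIn a x))) ≡ suc m * 𝟙 (H (not (parity a)))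
sum-punchIn-parity m a H Ha≡false = begin
  ∑[ x < suc (m * 2) ] 𝟙 (H (parity (punchIn a x)))
    ≡⟨ cong (λ b → 𝟙 b + ∑[ x < suc (m * 2) ] 𝟙 (H (parity (punchIn a x)))) Ha≡false ⟨
  𝟙 (H (parity a)) + ∑[ x < suc (m * 2) ] 𝟙 (H (parity (punchIn a x)))
    ≡⟨ sum-remove {i = a} (λ x → 𝟙 (H (parity x))) ⟨
  ∑[ x < suc m * 2 ] 𝟙 (H (parity x))            ≡⟨ sum-parity (suc m) (𝟙 ∘ H) ⟩
  suc m * 𝟙 (H true) + suc m * 𝟙 (H false)       ≡⟨ *-𝟙-true+false≡not (suc m) H (parity a) Ha≡false ⟩
  suc m * 𝟙 (H (not (parity a)))                  ∎

byParity : ∀ {q} → (Bool → Bool → Bool → Bool) → Code q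
byParity G (x , y , z) = G (parity x) (parity y) (parity z)

flipCount : (Bool → Bool → Bool → Bool) → Bool → Bool → Bool → ℕ
flipCount G a b c = 𝟙 (G (not a) b c) + 𝟙 (G a (not b) c) + 𝟙 (G a b (not c))

nbrsIn-byParity : ∀ m (G : Bool → Bool → Bool → Bool) (a b c : Fin (suc m * 2)) →
  G (parity a) (parity b) (parity c) ≡ false →
  nbrsIn (byParity G) (a , b , c) ≡ suc m * flipCount G (parity a) (parity b) (parity c)
nbrsIn-byParity m G a b c Gv≡false = begin
  nbrsIn (byParity G) (a , b , c)     ≡⟨ nbrsIn-lines (byParity G) a b c ⟩
  ∑[ x < n ] 𝟙 (G (parity (punchIn a x)) pb pc) + ∑[ y < n ] 𝟙 (G pa (parity (punchIn b y)) pc) +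
  ∑[ z < n ] 𝟙 (G pa pb (parity (punchIn c z)))
    ≡⟨ cong₂ _+_ (cong₂ _+_ (sum-punchIn-parity m a (λ t → G t pb pc) Gv≡false)
                            (sum-punchIn-parity m b (λ t → G pa t pc) Gv≡false))
                 (sum-punchIn-parity m c (λ t → G pa pb t) Gv≡false) ⟩
  M * 𝟙 (G (not pa) pb pc) + M * 𝟙 (G pa (not pb) pc) + M * 𝟙 (G pa pb (not pc))
    ≡⟨ cong (_+ M * 𝟙 (G pa pb (not pc))) (*-distribˡ-+ M (𝟙 (G (not pa) pb pc)) _) ⟨
  M * (𝟙 (G (not pa) pb pc) + 𝟙 (G pa (not pb) pc)) + M * 𝟙 (G pa pb (not pc))
    ≡⟨ *-distribˡ-+ M (𝟙 (G (not pa) pb pc) + 𝟙 (G pa (not pb) pc)) _ ⟨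
  M * flipCount G pa pb pc            ∎
  where
  n M : ℕ
  n = suc (m * 2)
  M = suc m
  pa pb pc : Bool
  pa = parity a
  pb = parity b
  pc = parity c

allEqual : Bool → Bool → Bool → Bool
allEqual true  true  true  = true
allEqual false false false = true
allEqual _     _     _     = false

sameParity : ∀ {q} → Code q
sameParity = byParity allEqual

flipCount-inside : ∀ a b c → allEqual a b c ≡ true → flipCount (λ x y z → not (allEqual x y z)) a b c ≡ 3
flipCount-inside true  true  true  _ = refl
flipCount-inside false false false _ = refl
flipCount-inside true  true  false ()
flipCount-inside true  false true  ()
flipCount-inside true  false false ()
flipCount-inside false true  true  ()
flipCount-inside false true  false ()
flipCount-inside false false true  ()

flipCount-outside : ∀ a b c → allEqual a b c ≡ false → flipCount allEqual a b c ≡ 1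
flipCount-outside true  true  true  ()
flipCount-outside false false false ()
flipCount-outside true  true  false _ = refl
flipCount-outside true  false true  _ = refl
flipCount-outside true  false false _ = refl
flipCount-outside false true  true  _ = refl
flipCount-outside false true  false _ = refl
flipCount-outside false false true  _ = refl

sameParity-isCRC1 : ∀ m → IsCRC1 (suc m * 2) sameParity (suc m * 3) (suc m)
sameParity-isCRC1 m = record
  { nonempty = (zero , zero , zero) , refl
  ; proper   = (zero , zero , suc zero) , refl
  ; β≥1      = s≤s z≤n
  ; γ≥1      = s≤s z≤n
  -- nbrsOut of a parity code is nbrsIn of the complementary parity code
  ; inC      = λ { (a , b , c) v∈C →
      trans (nbrsIn-byParity m (λ x y z → not (allEqual x y z)) a b c (cong not v∈C))
            (cong (suc m *_) (flipCount-inside _ _ _ v∈C)) }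
  ; outC     = λ { (a , b , c) v∉C →
      trans (nbrsIn-byParity m allEqual a b c v∉C)
            (trans (cong (suc m *_) (flipCount-outside _ _ _ v∉C)) (*-identityʳ (suc m))) }
  }

proposition7 : (q : ℕ) → 2 ≤ q → 2 ∣ q →
    ∃[ C ] ∃[ β ] (IsCRC1 q C β (q / 2) × HasEigenvalueλ₂ q β (q / 2))
proposition7 .(zero * 2)  ()  (divides zero    refl)
proposition7 .(suc m * 2) _   (divides (suc m) refl) rewrite m*n/n≡m (suc m) 2 ⦃ _ ⦄ =
  sameParity , suc m * 3 , sameParity-isCRC1 m , k*3+k≡2*[k*2] (suc m)
  where
  k*3+k≡2*[k*2] : ∀ k → k * 3 + k ≡ 2 * (k * 2)
  k*3+k≡2*[k*2] = solve-∀
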